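{- The map $\Phi$ on the set of marked perfect matchings with respect to $(n_1,\dots,n_k)$ is an involution, i.e. $\Phi(\Phi(\mathfrak{m}))=\mathfrak{m}$ for every such $\mathfrak{m}$.
   Context: Fix positive integers $n_1,\dots,n_k$ and $N=n_1+\dots+n_k$. Let $\pi$ be a permutation of $[N]$, viewed as a perfect matching with edges $e_i=(i,\overline{\pi(i)})$. An edge $e_i$ is homogeneous if $n_1+\dots+n_{r-1}+1\le i,\pi(i)\le n_1+\dots+n_r$ for some $r\in[k]$, inhomogeneous otherwise; $E^H(\pi)$ is the set of homogeneous edges. A marked perfect matching is a pair $\mathfrak{m}=(\pi,S)$ with $S$ a set of edges of $\pi$ containing all inhomogeneous edges (edges in $S$ are marked). $\mathrm{bind}^U_{\mathfrak{m}}(i)$ is $1$ plus the number of $u<i$ with $e_u\in S$; $\mathrm{bind}^L_{\mathfrak{m}}(j)$ is $1$ plus the number of $v<j$ such that the edge with lower endpoint $\bar v$ is in $S$; $\mathrm{bdiff}_{\mathfrak{m}}(e_i)=\mathrm{bind}^L_{\mathfrak{m}}(\pi(i))-\mathrm{bind}^U_{\mathfrak{m}}(i)$. Two edges $e_a,e_b$ cross if $(a-b)(\pi(a)-\pi(b))<0$; $e_j$ crosses $e_i$ from the left (equivalently $e_i$ crosses $e_j$ from the right) if $j<i$ and $\pi(j)>\pi(i)$. A homogeneous edge $e$ is convertible in $\mathfrak{m}$ if: when $e\notin S$, every edge $e'$ crossing $e$ either crosses $e$ from the left with $\mathrm{bdiff}_{\mathfrak{m}}(e')\ge0$ or crosses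 $e$ from the right with $\mathrm{bdiff}_{\mathfrak{m}}(e')\le-1$; when $e\in S$, every edge $e'$ crossing $e$ either crosses $e$ from the left with $\mathrm{bdiff}_{\mathfrak{m}}(e')>0$ or crosses $e$ from the right with $\mathrm{bdiff}_{\mathfrak{m}}(e')<-1$. $\triangle$ denotes symmetric difference. The map $\Phi$ on marked perfect matchings is defined as follows. Case 0: if $E^H(\pi)=\emptyset$, $\Phi(\mathfrak{m})=\mathfrak{m}$. Case 1: if $E^H(\pi)\ne\emptyset$ and $\mathrm{bdiff}_{\mathfrak{m}}(e)\ge0$ for all $e\in E^H(\pi)$, then $\Phi(\mathfrak{m})=(\pi,S\triangle\{e_i\})$ where $\pi(i)=\min\{\pi(j):e_j\in E^H(\pi)\}$. Case 2: otherwise let $i=\min\{j: e_j\in E^H(\pi),\ \mathrm{bdiff}_{\mathfrak{m}}(e_j)<0\}$; (a) if $e_i$ is convertible in $\mathfrak{m}$, $\Phi(\mathfrak{m})=(\pi,S\triangle\{e_i\})$; (b) if not, $\Phi(\mathfrak{m})=(\pi,S\triangle\{e_{i'}\})$ with $i'=\max\{j<i: e_j\in E^H(\pi),\ \mathrm{bdiff}_{\mathfrak{m}}(e_j)=0,\ e_j\text{ crosses } e_i\}$ (this set is nonempty in case (b), so $\Phi$ is well defined). -}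

module Defs where

open import Data.Bool.Base using (Bool; true; false; not; if_then_else_; _∧_; _∨_; T)
open import Data.Nat.Base as ℕ using (ℕ; zero; suc; _∸_)
open import Data.Integer.Base as ℤ using (ℤ; +_; _-_; 0ℤ; -1ℤ)
open import Data.Fin.Base using (Fin; toℕ)
open import Data.Fin.Permutation using (Permutation′; _⟨$⟩ʳ_; _⟨$⟩ˡ_)
open import Data.List.Base as List using (List; []; _∷_; allFin; filterᵇ; length)
open import Data.Nat.ListAction using (sum)
open import Data.Maybe.Base using (Maybe; just; nothing)
open import Data.Vec.Base using (Vec; lookup; updateAt)
open import Data.Product.Base using (_×_; _,_)

-- Indices are 0-based: [N] = {1..N} is represented by Fin N (i ↦ i+1).
-- A composition (n₁,…,n_k) is a list of naturals (positivity is a hypothesis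
-- of the theorem); N = sum ns.

_<ᶻ_ : ℤ → ℤ → Bool
a <ᶻ b = not (b ℤ.≤ᵇ a)

allᵇ : {A : Set} → (A → Bool) → List A → Bool
allᵇ p []       = true
allᵇ p (x ∷ xs) = p x ∧ allᵇ p xs

-- block ns i = r-1 where position i (0-based) lies in the r-th block.
block : List ℕ → ℕ → ℕ
block []       i = 0
block (n ∷ ns) i = if i ℕ.<ᵇ n then 0 else suc (block ns (i ∸ n))

-- A marking S of the edges of π: S is a subset of edge indices (e_i ↦ i).
Marking : ℕ → Set
Marking N = Vec Bool N

module _ (ns : List ℕ) (π : Permutation′ (sum ns)) where

  N : ℕ
  N = sum ns

  -- edge e_i = (i, π(i)) is homogeneous
  homogeneous : Fin N → Bool
  homogeneous i = block ns (toℕ i) ℕ.≡ᵇ block ns (toℕ (π ⟨$⟩ʳ i))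

  indices : List (Fin N)
  indices = allFin N

  IsMarked : Marking N → Set
  IsMarked S = ∀ i → T (not (homogeneous i)) → T (lookup S i)

  module _ (S : Marking N) where

    marked : Fin N → Bool
    marked i = lookup S i

    bindU : Fin N → ℕ
    bindU i = suc (length (filterᵇ (λ u → (toℕ u ℕ.<ᵇ toℕ i) ∧ marked u) indices))

    bindL : Fin N → ℕ
    bindL j = suc (length (filterᵇ (λ v → (toℕ v ℕ.<ᵇ toℕ j) ∧ marked (π ⟨$⟩ˡ v)) indices))

    bdiff : Fin N → ℤ
    bdiff i = (+ bindL (π ⟨$⟩ʳ i)) - (+ bindU i)

    crossesFromLeft : Fin N → Fin N → Bool
    crossesFromLeft j i = (toℕ j ℕ.<ᵇ toℕ i) ∧ (toℕ (π ⟨$⟩ʳ i) ℕ.<ᵇ toℕ (π ⟨$⟩ʳ j))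

    cross : Fin N → Fin N → Bool
    cross a b = crossesFromLeft a b ∨ crossesFromLeft b a

    convertible : Fin N → Bool
    convertible i =
      if marked i
      then allᵇ (λ j → (not (crossesFromLeft j i) ∨ (0ℤ <ᶻ bdiff j))
                    ∧ (not (crossesFromLeft i j) ∨ (bdiff j <ᶻ -1ℤ))) indices
      else allᵇ (λ j → (not (crossesFromLeft j i) ∨ (0ℤ ℤ.≤ᵇ bdiff j))
                    ∧ (not (crossesFromLeft i j) ∨ (bdiff j ℤ.≤ᵇ -1ℤ))) indices

    toggle : Fin N → Marking N
    toggle i = updateAt S i not

    homs : List (Fin N)
    homs = filterᵇ homogeneous indices

    negHoms : List (Fin N)
    negHoms = filterᵇ (λ j → bdiff j <ᶻ 0ℤ) homs

    argminπ : Fin N → List (Fin N) → Fin N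
    argminπ best []      = best
    argminπ best (x ∷ xs) =
      if toℕ (π ⟨$⟩ʳ x) ℕ.<ᵇ toℕ (π ⟨$⟩ʳ best) then argminπ x xs else argminπ best xs

    case2bCandidates : Fin N → List (Fin N)
    case2bCandidates i =
      filterᵇ (λ j → (toℕ j ℕ.<ᵇ toℕ i) ∧ (bdiff j ℤ.≤ᵇ 0ℤ) ∧ (0ℤ ℤ.≤ᵇ bdiff j) ∧ cross j i) homs

    -- Case 2(b): toggle the last (i.e. maximal-index) candidate.  If the candidate
    -- set were empty (impossible by the paper), S is returned unchanged.
    case2b : Maybe (Fin N) → Marking N
    case2b (just i') = toggle i'
    case2b nothing   = S

    case2 : Fin N → Marking N
    case2 i = if convertible i then toggle i else case2b (List.last (case2bCandidates i))

    case12 : Fin N → List (Fin N) → List (Fin N) → Marking N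
    case12 h hs []      = toggle (argminπ h hs)
    case12 h hs (i ∷ _) = case2 i

    -- The marking of Φ(π, S) = (π, Φ-marking S); π is unchanged.
    Φ-marking-aux : List (Fin N) → Marking N
    Φ-marking-aux []       = S
    Φ-marking-aux (h ∷ hs) = case12 h hs negHoms

    Φ-marking : Marking N
    Φ-marking = Φ-marking-aux homs

-- In every case Φ toggles a single homogeneous edge e_t (or fixes the
-- marking), and the toggled marking falls into the same case with the same edge
-- selected, so Φ toggles e_t back. Adding e_t to the marking changes bdiff(e_k) only
-- when e_t crosses e_k: by +1 when from the right, by −1 when from the left. In case 1,
-- e_t has the leftmost lower endpoint among homogeneous edges, so it crosses none of
-- them from the left. In case 2 the first negative edge e_i stays first, because edges
-- crossing a homogeneous edge from the left have bdiff ≥ 0: an inhomogeneous one runs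
-- across a block boundary, at which the marked edges above and below are equinumerous.
-- In case 2(b) the edge e_i is necessarily marked, and the last candidate e_t stays
-- the last one since a later candidate would contradict the counting inequalities.

module Submission where

open import Defs
open import Data.Nat.Base using (ℕ; _<_)
open import Data.Nat.ListAction using (sum)
open import Data.List.Base using (List)
open import Data.List.Relation.Unary.All using (All)
open import Data.Fin.Permutation using (Permutation′)
open import Data.Product.Base using (_×_)
open import Relation.Binary.PropositionalEquality using (_≡_)

import Algebra.Properties.CommutativeMonoid.Sum as Sum
open import Data.Bool.Base using (Bool; true; false; not; if_then_else_; _∧_; T)
open import Data.Bool.Properties using (not-involutive; ∧-zeroʳ)
open import Data.Nat.Base as ℕ using (zero; suc; _+_; _≤_; z≤n; s≤s; _<ᵇ_)
open import Data.Nat.Properties as ℕ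
  using (≤-refl; ≤-trans; ≤-antisym; <-irrefl; <-asym; ≤-<-trans; <-≤-trans; <⇒≤; ≮⇒≥; ≰⇒>; <⇒≱;
         ≤∧≢⇒<; ≤-pred; m≤n⇒m≤1+n; n≤1+n; n<1+n; +-suc; +-cancelʳ-≡; ∸-monoˡ-≤;
         <ᵇ-reflects-<; ≡ᵇ⇒≡; ≡⇒≡ᵇ; +-0-commutativeMonoid)
open import Data.Integer.Base as ℤ using (ℤ; _⊖_; 0ℤ; -1ℤ)
open import Data.Integer.Properties using ([+m]-[+n]≡m⊖n; [1+m]⊖[1+n]≡m⊖n)
open import Data.Fin.Base as Fin using (Fin; toℕ; zero; suc)
open import Data.Fin.Properties as Fin using (toℕ-injective; _≟_; _<?_; <-cmp)
open import Data.Fin.Permutation using (_⟨$⟩ʳ_; _⟨$⟩ˡ_; inverseˡ)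
open import Data.List.Base using ([]; _∷_; allFin; filterᵇ; length; map; last)
open import Data.List.Properties using (length-map; map-tabulate; last-map; filter-none)
open import Data.List.Relation.Unary.All using ([]; _∷_)
open import Data.List.Relation.Unary.All.Properties using (tabulate⁺; tabulate⁻)
open import Data.List.Relation.Unary.Any using (here; there)
open import Data.List.Membership.Propositional using (_∈_)
open import Data.List.Membership.Propositional.Properties using (∈-filter⁺; ∈-filter⁻; ∈-allFin)
open import Data.Maybe.Base as Maybe using (just; nothing; _<∣>_)
open import Data.Vec.Base using (lookup)
open import Data.Vec.Properties using (lookup∘updateAt; lookup∘updateAt′; updateAt-updateAt; updateAt-id-local)
open import Data.Product.Base using (_,_; ∃; ∃₂; proj₁; proj₂)
open import Data.Sum.Base using (_⊎_; inj₁; inj₂)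
open import Data.Empty using (⊥-elim)
open import Data.Unit.Base using (tt)
open import Function.Base using (_∘_; id)
open import Relation.Binary.Definitions using (tri<; tri≈; tri>)
open import Relation.Binary.PropositionalEquality using (refl; sym; trans; cong; cong₂; subst; subst₂; _≢_; ≢-sym; module ≡-Reasoning)
open import Relation.Nullary.Negation using (¬_; contradiction)
open import Relation.Nullary.Decidable.Core using (yes; no; T?)
open import Relation.Nullary.Reflects
  using (Reflects; ofʸ; ofⁿ; det; fromEquivalence; ¬-reflects; _×-reflects_; _⊎-reflects_; _→-reflects_)

-- Counting

count : ∀ {n} → (Fin n → Bool) → ℕ
count {zero}  p = 0
count {suc n} p = if p zero then suc (count (p ∘ suc)) else count (p ∘ suc)

filterᵇ-map : ∀ {A B : Set} (f : A → B) (p : B → Bool) xs →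
              filterᵇ p (map f xs) ≡ map f (filterᵇ (p ∘ f) xs)
filterᵇ-map f p []       = refl
filterᵇ-map f p (x ∷ xs) with p (f x)
... | true  = cong (f x ∷_) (filterᵇ-map f p xs)
... | false = filterᵇ-map f p xs

filterᵇ-allFin-suc : ∀ {n} (p : Fin (suc n) → Bool) →
  filterᵇ p (allFin (suc n)) ≡
    (if p zero then zero ∷ map suc (filterᵇ (p ∘ suc) (allFin n))
               else map suc (filterᵇ (p ∘ suc) (allFin n)))
filterᵇ-allFin-suc {n} p with p zero | filterᵇ-map suc p (allFin n)
... | true  | tail = cong (zero ∷_) (trans (cong (filterᵇ p) (sym (map-tabulate id suc))) tail)
... | false | tail = trans (cong (filterᵇ p) (sym (map-tabulate id suc))) tail

length-filterᵇ-allFin : ∀ {n} (p : Fin n → Bool) → length (filterᵇ p (allFin n)) ≡ count p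
length-filterᵇ-allFin {zero}  p = refl
length-filterᵇ-allFin {suc n} p rewrite filterᵇ-allFin-suc p with p zero
... | true  = cong suc (trans (length-map (Fin.suc {n}) (filterᵇ (p ∘ suc) (allFin n))) (length-filterᵇ-allFin (p ∘ suc)))
... | false = trans (length-map (Fin.suc {n}) (filterᵇ (p ∘ suc) (allFin n))) (length-filterᵇ-allFin (p ∘ suc))

count-cong : ∀ {n} {p q : Fin n → Bool} → (∀ x → p x ≡ q x) → count p ≡ count q
count-cong {zero}  eq = refl
count-cong {suc n} {p} {q} eq rewrite eq zero with q zero
... | true  = cong suc (count-cong (eq ∘ suc))
... | false = count-cong (eq ∘ suc)

count-mono : ∀ {n} {p q : Fin n → Bool} → (∀ x → T (p x) → T (q x)) → count p ≤ count q
count-mono {zero} p⇒q = z≤n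
count-mono {suc n} {p} {q} p⇒q with p zero | q zero | p⇒q zero
... | true  | true  | _ = s≤s (count-mono (p⇒q ∘ suc))
... | true  | false | f = ⊥-elim (f _)
... | false | true  | _ = ≤-trans (count-mono (p⇒q ∘ suc)) (n≤1+n _)
... | false | false | _ = count-mono (p⇒q ∘ suc)

count-mono-< : ∀ {n} {p q : Fin n → Bool} (w : Fin n) → (∀ x → T (p x) → T (q x)) →
               p w ≡ false → q w ≡ true → count p < count q
count-mono-< {suc n} {p} {q} zero p⇒q pw qw rewrite pw | qw = s≤s (count-mono (p⇒q ∘ suc))
count-mono-< {suc n} {p} {q} (suc w) p⇒q pw qw with p zero | q zero | p⇒q zero
... | true  | true  | _ = s≤s (count-mono-< w (p⇒q ∘ suc) pw qw)
... | true  | false | f = ⊥-elim (f _)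
... | false | true  | _ = ≤-trans (count-mono-< w (p⇒q ∘ suc) pw qw) (n≤1+n _)
... | false | false | _ = count-mono-< w (p⇒q ∘ suc) pw qw

count-insert : ∀ {n} {p q : Fin n → Bool} (w : Fin n) → (∀ x → x ≢ w → p x ≡ q x) →
               p w ≡ false → q w ≡ true → count q ≡ suc (count p)
count-insert {suc n} {p} {q} zero agree pw qw
  rewrite pw | qw = cong suc (sym (count-cong (λ x → agree (suc x) λ ())))
count-insert {suc n} {p} {q} (suc w) agree pw qw
  rewrite agree zero (λ ()) with q zero
... | true  = cong suc (count-insert w (λ x x≢w → agree (suc x) (x≢w ∘ Fin.suc-injective)) pw qw)
... | false = count-insert w (λ x x≢w → agree (suc x) (x≢w ∘ Fin.suc-injective)) pw qw

count-split : ∀ {n} (p r : Fin n → Bool) →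
              count p ≡ count (λ x → p x ∧ r x) + count (λ x → p x ∧ not (r x))
count-split {zero}  p r = refl
count-split {suc n} p r with p zero | r zero
... | true  | true  = cong suc (count-split (p ∘ suc) (r ∘ suc))
... | true  | false = trans (cong suc (count-split (p ∘ suc) (r ∘ suc))) (sym (+-suc _ _))
... | false | _     = count-split (p ∘ suc) (r ∘ suc)

private
  module ΣN = Sum +-0-commutativeMonoid

  indicator : Bool → ℕ
  indicator b = if b then 1 else 0

  count≡sum : ∀ {n} (p : Fin n → Bool) → count p ≡ ΣN.sum (indicator ∘ p)
  count≡sum {zero}  p = refl
  count≡sum {suc n} p with p zero
  ... | true  = cong suc (count≡sum (p ∘ suc))
  ... | false = count≡sum (p ∘ suc)

count-permute : ∀ {n} (π : Permutation′ n) (p : Fin n → Bool) → count (p ∘ (π ⟨$⟩ʳ_)) ≡ count p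
count-permute π p = begin
  count (p ∘ (π ⟨$⟩ʳ_))            ≡⟨ count≡sum (p ∘ (π ⟨$⟩ʳ_)) ⟩
  ΣN.sum (indicator ∘ p ∘ (π ⟨$⟩ʳ_)) ≡⟨ ΣN.sum-permute (indicator ∘ p) π ⟨
  ΣN.sum (indicator ∘ p)          ≡⟨ count≡sum p ⟨
  count p                         ∎
  where open ≡-Reasoning

-- Least and greatest solutions of a reflected predicate on Fin n

fromT : ∀ {A : Set} {b} → Reflects A b → T b → A
fromT (ofʸ a) _ = a

toT : ∀ {A : Set} {b} → Reflects A b → A → T b
toT (ofʸ _)  _ = tt
toT (ofⁿ ¬a) a = ¬a a

Reflects-map : ∀ {A B : Set} {b} → (A → B) → (B → A) → Reflects A b → Reflects B b
Reflects-map f g (ofʸ a)  = ofʸ (f a)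
Reflects-map f g (ofⁿ ¬a) = ofⁿ (¬a ∘ g)

allᵇ-reflects : ∀ {A : Set} {P : A → Set} {p : A → Bool} →
                (∀ x → Reflects (P x) (p x)) → ∀ xs → Reflects (All P xs) (allᵇ p xs)
allᵇ-reflects P? []       = ofʸ []
allᵇ-reflects P? (x ∷ xs) =
  Reflects-map (λ (px , pxs) → px ∷ pxs) (λ { (px ∷ pxs) → px , pxs })
               (P? x ×-reflects allᵇ-reflects P? xs)

allᵇ-allFin-reflects : ∀ {n} {P : Fin n → Set} {p : Fin n → Bool} →
                       (∀ x → Reflects (P x) (p x)) → Reflects (∀ x → P x) (allᵇ p (allFin n))
allᵇ-allFin-reflects P? = Reflects-map tabulate⁻ tabulate⁺ (allᵇ-reflects P? _)

filterᵇ-filterᵇ : ∀ {A : Set} (p q : A → Bool) xs →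
                  filterᵇ q (filterᵇ p xs) ≡ filterᵇ (λ x → p x ∧ q x) xs
filterᵇ-filterᵇ p q []       = refl
filterᵇ-filterᵇ p q (x ∷ xs) with p x
... | false = filterᵇ-filterᵇ p q xs
... | true with q x
...   | true  = cong (x ∷_) (filterᵇ-filterᵇ p q xs)
...   | false = filterᵇ-filterᵇ p q xs

Least : ∀ {n} → (Fin n → Set) → Fin n → Set
Least P i = P i × (∀ {k} → k Fin.< i → ¬ P k)

Greatest : ∀ {n} → (Fin n → Set) → Fin n → Set
Greatest P t = P t × (∀ {k} → t Fin.< k → ¬ P k)

least-unique : ∀ {n} {P : Fin n → Set} {i j} → Least P i → Least P j → i ≡ j
least-unique {i = i} {j} (Pi , i-min) (Pj , j-min) with <-cmp i j
... | tri< i<j _ _ = contradiction Pi (j-min i<j)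
... | tri≈ _ i≡j _ = i≡j
... | tri> _ _ j<i = contradiction Pj (i-min j<i)

greatest-unique : ∀ {n} {P : Fin n → Set} {i j} → Greatest P i → Greatest P j → i ≡ j
greatest-unique {i = i} {j} (Pi , i-max) (Pj , j-max) with <-cmp i j
... | tri< i<j _ _ = contradiction Pj (i-max i<j)
... | tri≈ _ i≡j _ = i≡j
... | tri> _ _ j<i = contradiction Pi (j-max j<i)

module _ {n} {P : Fin n → Set} {p : Fin n → Bool} (P? : ∀ x → Reflects (P x) (p x)) where

  ∈-filterᵇ-allFin : ∀ {x} → P x → x ∈ filterᵇ p (allFin n)
  ∈-filterᵇ-allFin {x} Px = ∈-filter⁺ (T? ∘ p) (∈-allFin x) (toT (P? x) Px)

  filterᵇ-allFin-[] : filterᵇ p (allFin n) ≡ [] → ∀ x → ¬ P x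
  filterᵇ-allFin-[] eq x Px with () ← subst (x ∈_) eq (∈-filterᵇ-allFin Px)

  filterᵇ-allFin-[]⁺ : (∀ x → ¬ P x) → filterᵇ p (allFin n) ≡ []
  filterᵇ-allFin-[]⁺ ¬P = filter-none (T? ∘ p) (tabulate⁺ λ x → ¬P x ∘ fromT (P? x))

filterᵇ-allFin-head : ∀ {n} {P : Fin n → Set} {p} → (∀ x → Reflects (P x) (p x)) →
                      ∀ {i r} → filterᵇ p (allFin n) ≡ i ∷ r → Least P i
filterᵇ-allFin-head {suc n} {p = p} P? eq
  with p zero | P? zero | trans (sym (filterᵇ-allFin-suc p)) eq
... | true  | ofʸ P0  | refl = P0 , λ ()
... | false | ofⁿ ¬P0 | eq′ with filterᵇ (p ∘ suc) (allFin n) in eq″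
...   | j ∷ js with refl ← eq′ =
  let (Pj , j-min) = filterᵇ-allFin-head (P? ∘ suc) eq″
  in Pj , λ { {zero} _ → ¬P0 ; {suc k} (s≤s k<j) → j-min k<j }

filterᵇ-allFin-∷ : ∀ {n} {P : Fin n → Set} {p} → (∀ x → Reflects (P x) (p x)) →
                   ∀ {i} → Least P i → ∃ λ r → filterᵇ p (allFin n) ≡ i ∷ r
filterᵇ-allFin-∷ {n} {p = p} P? {i} least@(Pi , _)
  with filterᵇ p (allFin n) in eq | ∈-filterᵇ-allFin P? Pi
... | j ∷ r | _ rewrite least-unique least (filterᵇ-allFin-head P? eq) = r , refl

last-∷ : ∀ {A : Set} (x : A) xs → last (x ∷ xs) ≡ last xs <∣> just x
last-∷ x []       = refl
last-∷ x (y ∷ ys) = sym (last-∷-just y ys)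
  where
  last-∷-just : ∀ y ys → (last (y ∷ ys) <∣> just x) ≡ last (y ∷ ys)
  last-∷-just y []       = refl
  last-∷-just y (z ∷ zs) = last-∷-just z zs

last-filterᵇ-allFin-suc : ∀ {n} (p : Fin (suc n) → Bool) →
  last (filterᵇ p (allFin (suc n))) ≡
    (if p zero then Maybe.map suc (last (filterᵇ (p ∘ suc) (allFin n))) <∣> just zero
               else Maybe.map suc (last (filterᵇ (p ∘ suc) (allFin n))))
last-filterᵇ-allFin-suc {n} p with p zero | filterᵇ-allFin-suc p
... | true  | eq = trans (cong last eq) (trans (last-∷ zero (map suc F)) (cong (_<∣> just zero) (last-map suc F)))
  where F = filterᵇ (p ∘ suc) (allFin n)
... | false | eq = trans (cong last eq) (last-map suc (filterᵇ (p ∘ suc) (allFin n)))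

last≡nothing : ∀ {A : Set} {xs : List A} → last xs ≡ nothing → xs ≡ []
last≡nothing {xs = []}     _ = refl
last≡nothing {xs = x ∷ []}     ()
last≡nothing {xs = x ∷ y ∷ ys} eq with () ← last≡nothing {xs = y ∷ ys} eq

greatest-suc : ∀ {n} {P : Fin (suc n) → Set} {t} → Greatest (P ∘ suc) t → Greatest P (suc t)
greatest-suc (Pt , t-max) = Pt , λ { {suc k} (s≤s t<k) → t-max t<k }

filterᵇ-allFin-last : ∀ {n} {P : Fin n → Set} {p} → (∀ x → Reflects (P x) (p x)) →
                      ∀ {t} → last (filterᵇ p (allFin n)) ≡ just t → Greatest P t
filterᵇ-allFin-last {suc n} {p = p} P? eq
  with p zero | P? zero | trans (sym (last-filterᵇ-allFin-suc p)) eq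
... | true | ofʸ P0 | eq′ with last (filterᵇ (p ∘ suc) (allFin n)) in eF
...   | nothing with refl ← eq′ =
  P0 , λ { {suc k} _ → filterᵇ-allFin-[] (P? ∘ suc) (last≡nothing eF) k }
...   | just t′ with refl ← eq′ = greatest-suc (filterᵇ-allFin-last (P? ∘ suc) eF)
filterᵇ-allFin-last {suc n} {p = p} P? eq
    | false | ofⁿ _ | eq′ with last (filterᵇ (p ∘ suc) (allFin n)) in eF
...   | just t′ with refl ← eq′ = greatest-suc (filterᵇ-allFin-last (P? ∘ suc) eF)

filterᵇ-allFin-last⁺ : ∀ {n} {P : Fin n → Set} {p} → (∀ x → Reflects (P x) (p x)) →
                       ∀ {t} → Greatest P t → last (filterᵇ p (allFin n)) ≡ just t
filterᵇ-allFin-last⁺ {n} {p = p} P? {t} greatest@(Pt , _)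
  with last (filterᵇ p (allFin n)) in eq | ∈-filterᵇ-allFin P? Pt
... | just t′ | _ = cong just (greatest-unique (filterᵇ-allFin-last P? eq) greatest)
... | nothing | t∈ with () ← subst (t ∈_) (last≡nothing eq) t∈

⊖-suc-reflects : ∀ {A : Set} (test : ℤ → Bool) a b →
                 Reflects A (test (a ⊖ b)) → Reflects A (test (suc a ⊖ suc b))
⊖-suc-reflects test a b = subst (Reflects _) (cong test (sym ([1+m]⊖[1+n]≡m⊖n a b)))

0≤ᵇ⊖-reflects : ∀ a b → Reflects (b ≤ a) (0ℤ ℤ.≤ᵇ a ⊖ b)
0≤ᵇ⊖-reflects zero    zero    = ofʸ z≤n
0≤ᵇ⊖-reflects (suc a) zero    = ofʸ z≤n
0≤ᵇ⊖-reflects zero    (suc b) = ofⁿ λ ()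
0≤ᵇ⊖-reflects (suc a) (suc b) =
  ⊖-suc-reflects (0ℤ ℤ.≤ᵇ_) a b (Reflects-map s≤s ≤-pred (0≤ᵇ⊖-reflects a b))

⊖≤ᵇ0-reflects : ∀ a b → Reflects (a ≤ b) (a ⊖ b ℤ.≤ᵇ 0ℤ)
⊖≤ᵇ0-reflects zero    zero    = ofʸ z≤n
⊖≤ᵇ0-reflects (suc a) zero    = ofⁿ λ ()
⊖≤ᵇ0-reflects zero    (suc b) = ofʸ z≤n
⊖≤ᵇ0-reflects (suc a) (suc b) =
  ⊖-suc-reflects (ℤ._≤ᵇ 0ℤ) a b (Reflects-map s≤s ≤-pred (⊖≤ᵇ0-reflects a b))

⊖≤ᵇ-1-reflects : ∀ a b → Reflects (a < b) (a ⊖ b ℤ.≤ᵇ -1ℤ)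
⊖≤ᵇ-1-reflects zero    zero    = ofⁿ λ ()
⊖≤ᵇ-1-reflects (suc a) zero    = ofⁿ λ ()
⊖≤ᵇ-1-reflects zero    (suc b) = ofʸ (s≤s z≤n)
⊖≤ᵇ-1-reflects (suc a) (suc b) =
  ⊖-suc-reflects (ℤ._≤ᵇ -1ℤ) a b (Reflects-map s≤s ≤-pred (⊖≤ᵇ-1-reflects a b))

-1≤ᵇ⊖-reflects : ∀ a b → Reflects (b ≤ suc a) (-1ℤ ℤ.≤ᵇ a ⊖ b)
-1≤ᵇ⊖-reflects zero    zero          = ofʸ z≤n
-1≤ᵇ⊖-reflects (suc a) zero          = ofʸ z≤n
-1≤ᵇ⊖-reflects zero    (suc zero)    = ofʸ (s≤s z≤n)
-1≤ᵇ⊖-reflects zero    (suc (suc b)) = ofⁿ λ { (s≤s ()) }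
-1≤ᵇ⊖-reflects (suc a) (suc b) =
  ⊖-suc-reflects (-1ℤ ℤ.≤ᵇ_) a b (Reflects-map s≤s ≤-pred (-1≤ᵇ⊖-reflects a b))

-- Block separators

block-mono : ∀ ms {x y} → x ≤ y → block ms x ≤ block ms y
block-mono []       x≤y = z≤n
block-mono (m ∷ ms) {x} {y} x≤y
  with x <ᵇ m | <ᵇ-reflects-< x m | y <ᵇ m | <ᵇ-reflects-< y m
... | true  | _       | _     | _       = z≤n
... | false | ofⁿ x≮m | true  | ofʸ y<m = contradiction (≤-<-trans x≤y y<m) x≮m
... | false | _       | false | _       = s≤s (block-mono ms (∸-monoˡ-≤ m x≤y))

SeparatesAt : (ℕ → ℕ) → ℕ → Set
SeparatesAt f c = ∀ {x y} → x < c → c ≤ y → f x < f y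

module _ {f : ℕ → ℕ} (f-mono : ∀ {x y} → x ≤ y → f x ≤ f y) where

  separator-between : ∀ {x} y → f x < f y → ∃ λ c → x < c × c ≤ y × SeparatesAt f c
  separator-between {x} zero fx<f0 = contradiction (f-mono z≤n) (λ f0≤fx → <-irrefl refl (<-≤-trans fx<f0 f0≤fx))
  separator-between {x} (suc y) fx<fy with f x ℕ.<? f y
  ... | yes fx<fy′ = let c , x<c , c≤y , sep = separator-between y fx<fy′ in c , x<c , m≤n⇒m≤1+n c≤y , sep
  ... | no  fx≮fy′ = suc y , ≰⇒> (λ y<x → <-irrefl refl (<-≤-trans fx<fy (f-mono y<x))) , ≤-refl ,
                     λ {a} {b} a<c c≤b → ≤-<-trans (≤-trans (f-mono (≤-pred a<c)) (≮⇒≥ fx≮fy′))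
                                                   (<-≤-trans fx<fy (f-mono c≤b))

module _ (ns : List ℕ) (π : Permutation′ (sum ns)) where

  Edge : Set
  Edge = Fin (sum ns)

  Marking′ : Set
  Marking′ = Marking (sum ns)

  πʳ : Edge → Edge
  πʳ = π ⟨$⟩ʳ_

  πʳ-injective : ∀ {j k} → πʳ j ≡ πʳ k → j ≡ k
  πʳ-injective {j} {k} eq = trans (sym (inverseˡ π)) (trans (cong (π ⟨$⟩ˡ_) eq) (inverseˡ π))

  top bot : Edge → ℕ
  top = toℕ
  bot = toℕ ∘ πʳ

  Homogeneous : Edge → Set
  Homogeneous k = block ns (top k) ≡ block ns (bot k)

  CrossesFromLeft : Edge → Edge → Set
  CrossesFromLeft j i = j Fin.< i × πʳ i Fin.< πʳ j

  countMarked : (Edge → ℕ) → Marking′ → ℕ → ℕ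
  countMarked pos S c = count (λ u → (pos u <ᵇ c) ∧ lookup S u)

  -- U S k and L S k are bind^U(k) − 1 and bind^L(π k) − 1, so that bdiff is L − U (bdiff≡).
  U L : Marking′ → Edge → ℕ
  U S k = countMarked top S (top k)
  L S k = countMarked bot S (bot k)

  bdiff≡ : ∀ S k → bdiff ns π S k ≡ L S k ⊖ U S k
  bdiff≡ S k = begin
    bdiff ns π S k                         ≡⟨ cong₂ (λ l u → ℤ.+ suc l ℤ.- ℤ.+ suc u)
                                                (length-filterᵇ-allFin lower) (length-filterᵇ-allFin upper) ⟩
    ℤ.+ suc (count lower) ℤ.- ℤ.+ suc (U S k) ≡⟨ cong (λ l → ℤ.+ suc l ℤ.- ℤ.+ suc (U S k)) lower≡L ⟩
    ℤ.+ suc (L S k) ℤ.- ℤ.+ suc (U S k)    ≡⟨ [+m]-[+n]≡m⊖n (suc (L S k)) (suc (U S k)) ⟩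
    suc (L S k) ⊖ suc (U S k)              ≡⟨ [1+m]⊖[1+n]≡m⊖n (L S k) (U S k) ⟩
    L S k ⊖ U S k                          ∎
    where
    open ≡-Reasoning
    lower upper : Edge → Bool
    lower v = (toℕ v <ᵇ bot k) ∧ lookup S (π ⟨$⟩ˡ v)
    upper u = (toℕ u <ᵇ top k) ∧ lookup S u
    lower≡L : count lower ≡ L S k
    lower≡L = trans (sym (count-permute π lower))
                    (count-cong λ u → cong ((bot u <ᵇ bot k) ∧_) (cong (lookup S) (inverseˡ π)))

  module _ (S : Marking′) (k : Edge) where

    private
      via-bdiff : ∀ {A : Set} (test : ℤ → Bool) → Reflects A (test (L S k ⊖ U S k)) → Reflects A (test (bdiff ns π S k))
      via-bdiff test = subst (Reflects _) (cong test (sym (bdiff≡ S k)))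

    bdiff≥0-reflects : Reflects (U S k ≤ L S k) (0ℤ ℤ.≤ᵇ bdiff ns π S k)
    bdiff≥0-reflects = via-bdiff (0ℤ ℤ.≤ᵇ_) (0≤ᵇ⊖-reflects _ _)

    bdiff≤0-reflects : Reflects (L S k ≤ U S k) (bdiff ns π S k ℤ.≤ᵇ 0ℤ)
    bdiff≤0-reflects = via-bdiff (ℤ._≤ᵇ 0ℤ) (⊖≤ᵇ0-reflects _ _)

    bdiff≤-1-reflects : Reflects (L S k < U S k) (bdiff ns π S k ℤ.≤ᵇ -1ℤ)
    bdiff≤-1-reflects = via-bdiff (ℤ._≤ᵇ -1ℤ) (⊖≤ᵇ-1-reflects _ _)

    bdiff<0-reflects : Reflects (L S k < U S k) (bdiff ns π S k <ᶻ 0ℤ)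
    bdiff<0-reflects = Reflects-map ≰⇒> <⇒≱ (¬-reflects bdiff≥0-reflects)

    bdiff>0-reflects : Reflects (U S k < L S k) (0ℤ <ᶻ bdiff ns π S k)
    bdiff>0-reflects = Reflects-map ≰⇒> <⇒≱ (¬-reflects bdiff≤0-reflects)

    bdiff<-1-reflects : Reflects (suc (L S k) < U S k) (bdiff ns π S k <ᶻ -1ℤ)
    bdiff<-1-reflects = Reflects-map ≰⇒> <⇒≱ (¬-reflects (via-bdiff (-1ℤ ℤ.≤ᵇ_) (-1≤ᵇ⊖-reflects _ _)))

  homogeneous-reflects : ∀ k → Reflects (Homogeneous k) (homogeneous ns π k)
  homogeneous-reflects k = fromEquivalence (≡ᵇ⇒≡ _ _) (≡⇒≡ᵇ _ _)

  crossesFromLeft-reflects : ∀ S j i → Reflects (CrossesFromLeft j i) (crossesFromLeft ns π S j i)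
  crossesFromLeft-reflects S j i = <ᵇ-reflects-< _ _ ×-reflects <ᵇ-reflects-< _ _

  ConvertibleUnmarked ConvertibleMarked : Marking′ → Edge → Set
  ConvertibleUnmarked S i = ∀ j → (CrossesFromLeft j i → U S j ≤ L S j)
                                × (CrossesFromLeft i j → L S j < U S j)
  ConvertibleMarked S i = ∀ j → (CrossesFromLeft j i → U S j < L S j)
                              × (CrossesFromLeft i j → suc (L S j) < U S j)

  Convertible : Marking′ → Edge → Set
  Convertible S i = if lookup S i then ConvertibleMarked S i else ConvertibleUnmarked S i

  convertible-reflects : ∀ S i → Reflects (Convertible S i) (convertible ns π S i)
  convertible-reflects S i with lookup S i
  ... | true  = allᵇ-allFin-reflects λ j →
                  (crossesFromLeft-reflects S j i →-reflects bdiff>0-reflects S j)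
                  ×-reflects (crossesFromLeft-reflects S i j →-reflects bdiff<-1-reflects S j)
  ... | false = allᵇ-allFin-reflects λ j →
                  (crossesFromLeft-reflects S j i →-reflects bdiff≥0-reflects S j)
                  ×-reflects (crossesFromLeft-reflects S i j →-reflects bdiff≤-1-reflects S j)

  module _ (S : Marking′) {i : Edge} where

    private
      ConvertibleWhen : Bool → Set
      ConvertibleWhen b = if b then ConvertibleMarked S i else ConvertibleUnmarked S i

    convertible-unmarked⁺ : lookup S i ≡ false → ConvertibleUnmarked S i → Convertible S i
    convertible-unmarked⁺ eq = subst ConvertibleWhen (sym eq)

    convertible-unmarked⁻ : lookup S i ≡ false → Convertible S i → ConvertibleUnmarked S i
    convertible-unmarked⁻ eq = subst ConvertibleWhen eq

    convertible-marked⁺ : lookup S i ≡ true → ConvertibleMarked S i → Convertible S i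
    convertible-marked⁺ eq = subst ConvertibleWhen (sym eq)

    convertible-marked⁻ : lookup S i ≡ true → Convertible S i → ConvertibleMarked S i
    convertible-marked⁻ eq = subst ConvertibleWhen eq

  Deficient : Marking′ → Edge → Set
  Deficient S k = Homogeneous k × L S k < U S k

  deficientTest : Marking′ → Edge → Bool
  deficientTest S k = homogeneous ns π k ∧ (bdiff ns π S k <ᶻ 0ℤ)

  deficient-reflects : ∀ S k → Reflects (Deficient S k) (deficientTest S k)
  deficient-reflects S k = homogeneous-reflects k ×-reflects bdiff<0-reflects S k

  negHoms≡ : ∀ S → negHoms ns π S ≡ filterᵇ (deficientTest S) (allFin _)
  negHoms≡ S = filterᵇ-filterᵇ (homogeneous ns π) _ (allFin _)

  Candidate : Marking′ → Edge → Edge → Set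
  Candidate S i j = Homogeneous j × CrossesFromLeft j i × L S j ≡ U S j

  candidateTest : Marking′ → Edge → Edge → Bool
  candidateTest S i j = homogeneous ns π j ∧ ((toℕ j <ᵇ toℕ i) ∧ (bdiff ns π S j ℤ.≤ᵇ 0ℤ)
                                              ∧ (0ℤ ℤ.≤ᵇ bdiff ns π S j) ∧ cross ns π S j i)

  candidate-reflects : ∀ S i j → Reflects (Candidate S i j) (candidateTest S i j)
  candidate-reflects S i j =
    Reflects-map to from
      (homogeneous-reflects j ×-reflects (<ᵇ-reflects-< _ _ ×-reflects (bdiff≤0-reflects S j
         ×-reflects (bdiff≥0-reflects S j ×-reflects
           (crossesFromLeft-reflects S j i ⊎-reflects crossesFromLeft-reflects S i j)))))
    where
    to : Homogeneous j × j Fin.< i × L S j ≤ U S j × U S j ≤ L S j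
         × (CrossesFromLeft j i ⊎ CrossesFromLeft i j) → Candidate S i j
    to (hj , j<i , L≤U , U≤L , inj₁ cross)     = hj , cross , ≤-antisym L≤U U≤L
    to (hj , j<i , L≤U , U≤L , inj₂ (i<j , _)) = contradiction i<j (<-asym j<i)
    from : Candidate S i j → Homogeneous j × j Fin.< i × L S j ≤ U S j × U S j ≤ L S j
           × (CrossesFromLeft j i ⊎ CrossesFromLeft i j)
    from (hj , cross@(j<i , _) , L≡U) =
      hj , j<i , ℕ.≤-reflexive L≡U , ℕ.≤-reflexive (sym L≡U) , inj₁ cross

  case2bCandidates≡ : ∀ S i → case2bCandidates ns π S i ≡ filterᵇ (candidateTest S i) (allFin _)
  case2bCandidates≡ S i = filterᵇ-filterᵇ (homogeneous ns π) _ (allFin _)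

  module _ (S : Marking′) where

    argminπ-∈ : ∀ best xs → argminπ ns π S best xs ∈ best ∷ xs
    argminπ-∈ best []       = here refl
    argminπ-∈ best (x ∷ xs) with toℕ (πʳ x) <ᵇ toℕ (πʳ best)
    ... | true  = there (argminπ-∈ x xs)
    ... | false with argminπ-∈ best xs
    ...   | here eq = here eq
    ...   | there m = there (there m)

    argminπ-minimal : ∀ best xs {k} → k ∈ best ∷ xs → πʳ (argminπ ns π S best xs) Fin.≤ πʳ k
    argminπ-minimal best [] (here refl) = ≤-refl
    argminπ-minimal best (x ∷ xs) k∈
      with toℕ (πʳ x) <ᵇ toℕ (πʳ best) | <ᵇ-reflects-< (toℕ (πʳ x)) (toℕ (πʳ best)) | k∈
    ... | true  | ofʸ x<best  | here refl          = ≤-trans (argminπ-minimal x xs (here refl)) (<⇒≤ x<best)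
    ... | true  | _           | there k∈xs         = argminπ-minimal x xs k∈xs
    ... | false | _           | here refl          = argminπ-minimal best xs (here refl)
    ... | false | ofⁿ x≮best | there (here refl)  = ≤-trans (argminπ-minimal best xs (here refl)) (≮⇒≥ x≮best)
    ... | false | _           | there (there k∈xs) = argminπ-minimal best xs (there k∈xs)

  record Adds (t : Edge) (A B : Marking′) : Set where
    field
      unmarked-before : lookup A t ≡ false
      marked-after    : lookup B t ≡ true
      agree-elsewhere : ∀ x → x ≢ t → lookup A x ≡ lookup B x

  open Adds

  toggle-adds : ∀ {S t} → lookup S t ≡ false → Adds t S (toggle ns π S t)
  toggle-adds {S} {t} eq = record
    { unmarked-before = eq
    ; marked-after    = trans (lookup∘updateAt t S) (cong not eq)
    ; agree-elsewhere = λ x x≢t → sym (lookup∘updateAt′ x t x≢t S)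
    }

  toggle-removes : ∀ {S t} → lookup S t ≡ true → Adds t (toggle ns π S t) S
  toggle-removes {S} {t} eq = record
    { unmarked-before = trans (lookup∘updateAt t S) (cong not eq)
    ; marked-after    = eq
    ; agree-elsewhere = λ x x≢t → lookup∘updateAt′ x t x≢t S
    }

  toggle-involutive : ∀ S t → toggle ns π (toggle ns π S t) t ≡ S
  toggle-involutive S t = trans (updateAt-updateAt t S) (updateAt-id-local t S (not-involutive _))

  toggle-preserves : (C : Marking′ → Set) → ∀ {S t} →
                     (∀ {A B} → Adds t A B → C A → C B) → (∀ {A B} → Adds t A B → C B → C A) →
                     C S → C (toggle ns π S t)
  toggle-preserves C {S} {t} adding removing CS with lookup S t in eq
  ... | false = adding (toggle-adds eq) CS
  ... | true  = removing (toggle-removes eq) CS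

  module _ (pos : Edge → ℕ) where

    countMarked-adds-< : ∀ {t A B c} → Adds t A B → pos t < c →
                         countMarked pos B c ≡ suc (countMarked pos A c)
    countMarked-adds-< {t} {c = c} adds t<c = count-insert t
      (λ x x≢t → cong ((pos x <ᵇ c) ∧_) (agree-elsewhere adds x x≢t))
      (trans (cong ((pos t <ᵇ c) ∧_) (unmarked-before adds)) (∧-zeroʳ _))
      (cong₂ _∧_ (det (<ᵇ-reflects-< _ _) (ofʸ t<c)) (marked-after adds))

    countMarked-adds-≮ : ∀ {t A B c} → Adds t A B → ¬ pos t < c →
                         countMarked pos B c ≡ countMarked pos A c
    countMarked-adds-≮ {t} {A} {B} {c} adds t≮c = count-cong same
      where
      same : ∀ x → (pos x <ᵇ c) ∧ lookup B x ≡ (pos x <ᵇ c) ∧ lookup A x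
      same x with x ≟ t
      ... | yes refl rewrite det (<ᵇ-reflects-< (pos t) c) (ofⁿ t≮c) = refl
      ... | no x≢t   = cong ((pos x <ᵇ c) ∧_) (sym (agree-elsewhere adds x x≢t))

    private
      <ᵇ-∧-mono : ∀ m s {c d} → c ≤ d → T ((m <ᵇ c) ∧ s) → T ((m <ᵇ d) ∧ s)
      <ᵇ-∧-mono m s {c} {d} c≤d h with m <ᵇ c | <ᵇ-reflects-< m c
      ... | true | ofʸ m<c rewrite det (<ᵇ-reflects-< m d) (ofʸ (<-≤-trans m<c c≤d)) = h

    countMarked-mono : ∀ S {c d} → c ≤ d → countMarked pos S c ≤ countMarked pos S d
    countMarked-mono S c≤d = count-mono λ x → <ᵇ-∧-mono (pos x) (lookup S x) c≤d

    countMarked-mono-marked : ∀ S {t d} → lookup S t ≡ true → pos t < d →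
                              suc (countMarked pos S (pos t)) ≤ countMarked pos S d
    countMarked-mono-marked S {t} {d} marked t<d = count-mono-< t
      (λ x → <ᵇ-∧-mono (pos x) (lookup S x) (<⇒≤ t<d))
      (cong (_∧ lookup S t) (det (<ᵇ-reflects-< (pos t) (pos t)) (ofⁿ (<-irrefl refl))))
      (cong₂ _∧_ (det (<ᵇ-reflects-< _ _) (ofʸ t<d)) marked)

  module _ {t A B} (adds : Adds t A B) where

    U-adds-< : ∀ {k} → t Fin.< k → U B k ≡ suc (U A k)
    U-adds-< = countMarked-adds-< top adds

    U-adds-≮ : ∀ {k} → ¬ t Fin.< k → U B k ≡ U A k
    U-adds-≮ = countMarked-adds-≮ top adds

    L-adds-< : ∀ {k} → πʳ t Fin.< πʳ k → L B k ≡ suc (L A k)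
    L-adds-< = countMarked-adds-< bot adds

    L-adds-≮ : ∀ {k} → ¬ πʳ t Fin.< πʳ k → L B k ≡ L A k
    L-adds-≮ = countMarked-adds-≮ bot adds

    adds-self : U B t ≡ U A t × L B t ≡ L A t
    adds-self = U-adds-≮ (<-irrefl refl) , L-adds-≮ (<-irrefl refl)

  module _ (S : Marking′) {j k : Edge} where

    U-mono : j Fin.≤ k → U S j ≤ U S k
    U-mono = countMarked-mono top S

    U-mono-marked : lookup S j ≡ true → j Fin.< k → suc (U S j) ≤ U S k
    U-mono-marked = countMarked-mono-marked top S

    L-mono : πʳ j Fin.≤ πʳ k → L S j ≤ L S k
    L-mono = countMarked-mono bot S

    L-mono-marked : lookup S j ≡ true → πʳ j Fin.< πʳ k → suc (L S j) ≤ L S k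
    L-mono-marked = countMarked-mono-marked bot S

  unmarked⇒homogeneous : ∀ {S u} → IsMarked ns π S → lookup S u ≡ false → Homogeneous u
  unmarked⇒homogeneous {S} {u} marked unmarked with block ns (top u) ℕ.≟ block ns (bot u)
  ... | yes hu  = hu
  ... | no  ¬hu with () ← subst T unmarked (marked u (toT (¬-reflects (homogeneous-reflects u)) ¬hu))

  module _ {c} (sep : SeparatesAt (block ns) c) where

    homogeneous-same-side : ∀ {u} → Homogeneous u → (top u <ᵇ c) ≡ (bot u <ᵇ c)
    homogeneous-same-side {u} hu
      with top u <ᵇ c | <ᵇ-reflects-< (top u) c | bot u <ᵇ c | <ᵇ-reflects-< (bot u) c
    ... | true  | _        | true  | _        = refl
    ... | false | _        | false | _        = refl
    ... | true  | ofʸ u<c  | false | ofⁿ u≮c = contradiction hu (ℕ.<⇒≢ (sep u<c (≮⇒≥ u≮c)))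
    ... | false | ofⁿ u≮c  | true  | ofʸ u<c = contradiction (sym hu) (ℕ.<⇒≢ (sep u<c (≮⇒≥ u≮c)))

    -- Only marked edges can cross a block boundary, and both sides count c positions.
    marked-balanced-at-separator : ∀ {S} → IsMarked ns π S → countMarked top S c ≡ countMarked bot S c
    marked-balanced-at-separator {S} marked = +-cancelʳ-≡ _ _ _ (begin
      count (λ u → upper u ∧ lookup S u) + count (λ u → upper u ∧ not (lookup S u))
        ≡⟨ count-split upper (lookup S) ⟨
      count upper                                           ≡⟨ count-permute π upper ⟨
      count lower                                           ≡⟨ count-split lower (lookup S) ⟩
      count (λ u → lower u ∧ lookup S u) + count (λ u → lower u ∧ not (lookup S u))
        ≡⟨ cong (count (λ u → lower u ∧ lookup S u) +_) (count-cong unmarked-same-side) ⟨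
      count (λ u → lower u ∧ lookup S u) + count (λ u → upper u ∧ not (lookup S u)) ∎)
      where
      open ≡-Reasoning
      upper lower : Edge → Bool
      upper u = top u <ᵇ c
      lower u = bot u <ᵇ c
      unmarked-same-side : ∀ u → upper u ∧ not (lookup S u) ≡ lower u ∧ not (lookup S u)
      unmarked-same-side u with lookup S u in eq
      ... | true  = trans (∧-zeroʳ _) (sym (∧-zeroʳ _))
      ... | false = cong (_∧ true) (homogeneous-same-side (unmarked⇒homogeneous {S} marked eq))

  forward-inhomogeneous-nonneg : ∀ {S j} → IsMarked ns π S → block ns (top j) < block ns (bot j) → U S j ≤ L S j
  forward-inhomogeneous-nonneg {S} {j} marked blocks-increase =
    let c , j<c , c≤πj , sep = separator-between (block-mono ns) (bot j) blocks-increase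
    in begin
      U S j                 ≤⟨ countMarked-mono top S (<⇒≤ j<c) ⟩
      countMarked top S c   ≡⟨ marked-balanced-at-separator sep {S} marked ⟩
      countMarked bot S c   ≤⟨ countMarked-mono bot S c≤πj ⟩
      L S j                 ∎
    where open ℕ.≤-Reasoning

  ¬deficient⇒nonneg : ∀ {S k} → Homogeneous k → ¬ Deficient S k → U S k ≤ L S k
  ¬deficient⇒nonneg hk ¬def = ≮⇒≥ λ neg → ¬def (hk , neg)

  -- A left crosser of a homogeneous edge runs from an earlier block to a later one, or is homogeneous itself.
  left-crosser-nonneg : ∀ {S i j} → IsMarked ns π S → Homogeneous i → (∀ {k} → k Fin.< i → ¬ Deficient S k) →
                        CrossesFromLeft j i → U S j ≤ L S j
  left-crosser-nonneg {S} {i} {j} marked hi earlier (j<i , πi<πj)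
    with block ns (top j) ℕ.≟ block ns (bot j)
  ... | yes hj = ¬deficient⇒nonneg {S} hj (earlier j<i)
  ... | no ¬hj = forward-inhomogeneous-nonneg {S} marked (≤∧≢⇒< blocks-weakly-increase ¬hj)
    where
    blocks-weakly-increase : block ns (top j) ≤ block ns (bot j)
    blocks-weakly-increase = begin
      block ns (top j) ≤⟨ block-mono ns (<⇒≤ j<i) ⟩
      block ns (top i) ≡⟨ hi ⟩
      block ns (bot i) ≤⟨ block-mono ns (<⇒≤ πi<πj) ⟩
      block ns (bot j) ∎
      where open ℕ.≤-Reasoning

  right-crosser-deficient : ∀ {S i j} → CrossesFromLeft i j → L S i < U S i → L S j < U S j
  right-crosser-deficient {S} (i<j , πj<πi) neg =
    ≤-<-trans (L-mono S (<⇒≤ πj<πi)) (<-≤-trans neg (U-mono S (<⇒≤ i<j)))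

  left-of-marked-positive : ∀ {S t j} → lookup S t ≡ true → U S t ≤ L S t → CrossesFromLeft j t → U S j < L S j
  left-of-marked-positive {S} marked nonneg (j<t , πt<πj) =
    ≤-<-trans (U-mono S (<⇒≤ j<t)) (≤-<-trans nonneg (L-mono-marked S marked πt<πj))

  private
    ≮∧≢⇒> : ∀ {a b : Edge} → ¬ a Fin.< b → a ≢ b → b Fin.< a
    ≮∧≢⇒> a≮b a≢b = ≤∧≢⇒< (≮⇒≥ a≮b) (λ eq → a≢b (toℕ-injective (sym eq)))

  module _ {t A B} (adds : Adds t A B) {k : Edge} where

    nonneg-adds : U A k ≤ L A k → (CrossesFromLeft t k → U A k < L A k) → U B k ≤ L B k
    nonneg-adds nonneg strict with t <? k | πʳ t <? πʳ k
    ... | yes t<k | yes πt<πk rewrite U-adds-< adds t<k | L-adds-< adds πt<πk = s≤s nonneg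
    ... | yes t<k | no  πt≮πk rewrite U-adds-< adds t<k | L-adds-≮ adds πt≮πk =
      strict (t<k , ≮∧≢⇒> πt≮πk (Fin.<⇒≢ t<k ∘ πʳ-injective))
    ... | no  t≮k | yes πt<πk rewrite U-adds-≮ adds t≮k | L-adds-< adds πt<πk = m≤n⇒m≤1+n nonneg
    ... | no  t≮k | no  πt≮πk rewrite U-adds-≮ adds t≮k | L-adds-≮ adds πt≮πk = nonneg

    nonneg-removes : U B k ≤ L B k → (CrossesFromLeft k t → U B k < L B k) → U A k ≤ L A k
    nonneg-removes nonneg strict with t <? k | πʳ t <? πʳ k
    ... | yes t<k | yes πt<πk rewrite U-adds-< adds t<k | L-adds-< adds πt<πk = ≤-pred nonneg
    ... | yes t<k | no  πt≮πk rewrite U-adds-< adds t<k | L-adds-≮ adds πt≮πk = <⇒≤ nonneg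
    ... | no  t≮k | yes πt<πk rewrite U-adds-≮ adds t≮k | L-adds-< adds πt<πk =
      ≤-pred (strict (≮∧≢⇒> t≮k (Fin.<⇒≢ πt<πk ∘ cong πʳ) , πt<πk))
    ... | no  t≮k | no  πt≮πk rewrite U-adds-≮ adds t≮k | L-adds-≮ adds πt≮πk = nonneg

  -- The three cases of Φ

  NoDeficient : Marking′ → Set
  NoDeficient S = ∀ k → ¬ Deficient S k

  LowestHomogeneous : Edge → Set
  LowestHomogeneous t = Homogeneous t × (∀ {k} → Homogeneous k → πʳ t Fin.≤ πʳ k)

  module _ {t A B} (adds : Adds t A B) (lowest : LowestHomogeneous t) where

    -- e_t crosses no homogeneous edge from the left, since its lower endpoint is the leftmost one.
    no-deficient-adds : NoDeficient A → NoDeficient B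
    no-deficient-adds none k (hk , neg) =
      <⇒≱ neg (nonneg-adds adds (¬deficient⇒nonneg {A} hk (none k))
                 λ (_ , πk<πt) → contradiction (proj₂ lowest hk) (<⇒≱ πk<πt))

    no-deficient-removes : NoDeficient B → NoDeficient A
    no-deficient-removes none k (hk , neg) =
      <⇒≱ neg (nonneg-removes adds (¬deficient⇒nonneg {B} hk (none k))
                 (left-of-marked-positive {B} (marked-after adds)
                    (¬deficient⇒nonneg {B} (proj₁ lowest) (none t))))

  Case2a : Marking′ → Edge → Set
  Case2a S i = Least (Deficient S) i × Convertible S i

  module _ {i A B} (adds : Adds i A B) where

    private
      left-crosser-adds : ∀ {j} → CrossesFromLeft j i → U B j ≡ U A j × L B j ≡ suc (L A j)
      left-crosser-adds (j<i , πi<πj) = U-adds-≮ adds (<-asym j<i) , L-adds-< adds πi<πj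

      right-crosser-adds : ∀ {j} → CrossesFromLeft i j → U B j ≡ suc (U A j) × L B j ≡ L A j
      right-crosser-adds (i<j , πj<πi) = U-adds-< adds i<j , L-adds-≮ adds (<-asym πj<πi)

      convertible-adds : ConvertibleUnmarked A i → ConvertibleMarked B i
      convertible-adds conv j =
        (λ cross → let eqU , eqL = left-crosser-adds cross
                   in subst₂ _<_ (sym eqU) (sym eqL) (s≤s (proj₁ (conv j) cross))) ,
        (λ cross → let eqU , eqL = right-crosser-adds cross
                   in subst₂ _<_ (cong suc (sym eqL)) (sym eqU) (s≤s (proj₂ (conv j) cross)))

      convertible-removes : ConvertibleMarked B i → ConvertibleUnmarked A i
      convertible-removes conv j =
        (λ cross → let eqU , eqL = left-crosser-adds cross
                   in ≤-pred (subst₂ _<_ eqU eqL (proj₁ (conv j) cross))) ,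
        (λ cross → let eqU , eqL = right-crosser-adds cross
                   in ≤-pred (subst₂ _<_ (cong suc eqL) eqU (proj₂ (conv j) cross)))

      first-deficient-adds : Least (Deficient A) i → Least (Deficient B) i
      first-deficient-adds ((hi , neg) , earlier) =
        (hi , subst₂ _<_ (sym (proj₂ (adds-self adds))) (sym (proj₁ (adds-self adds))) neg) ,
        λ {k} k<i (hk , negB) →
          <⇒≱ negB (nonneg-adds adds (¬deficient⇒nonneg {A} hk (earlier k<i))
                      λ (i<k , _) → contradiction k<i (<-asym i<k))

      first-deficient-removes : ConvertibleMarked B i → Least (Deficient B) i → Least (Deficient A) i
      first-deficient-removes conv ((hi , neg) , earlier) =
        (hi , subst₂ _<_ (proj₂ (adds-self adds)) (proj₁ (adds-self adds)) neg) ,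
        λ {k} k<i (hk , negA) →
          <⇒≱ negA (nonneg-removes adds (¬deficient⇒nonneg {B} hk (earlier k<i))
                      λ cross → proj₁ (conv k) cross)

    case2a-adds : Case2a A i → Case2a B i
    case2a-adds (least , conv) =
      first-deficient-adds least ,
      convertible-marked⁺ B (marked-after adds)
        (convertible-adds (convertible-unmarked⁻ A (unmarked-before adds) conv))

    case2a-removes : Case2a B i → Case2a A i
    case2a-removes (least , conv) =
      let convertible-B = convertible-marked⁻ B (marked-after adds) conv
      in first-deficient-removes convertible-B least ,
         convertible-unmarked⁺ A (unmarked-before adds) (convertible-removes convertible-B)

  Case2b : Marking′ → Edge → Edge → Set
  Case2b S i t = Least (Deficient S) i × lookup S i ≡ true × Greatest (Candidate S i) t

  module _ (S : Marking′) {i : Edge} where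

    first-deficient-convertibleUnmarked : IsMarked ns π S → Least (Deficient S) i → ConvertibleUnmarked S i
    first-deficient-convertibleUnmarked marked ((hi , neg) , earlier) j =
      left-crosser-nonneg {S} marked hi earlier , λ cross → right-crosser-deficient {S} cross neg

    first-deficient-marked : IsMarked ns π S → Least (Deficient S) i → ¬ Convertible S i → lookup S i ≡ true
    first-deficient-marked marked least ¬conv = by-marking (lookup S i) refl
      where
      by-marking : ∀ b → lookup S i ≡ b → lookup S i ≡ true
      by-marking true  eq = eq
      by-marking false eq =
        contradiction (convertible-unmarked⁺ S eq (first-deficient-convertibleUnmarked marked least)) ¬conv

    candidate-blocks-conversion : ∀ {t} → lookup S i ≡ true → Candidate S i t → ¬ Convertible S i
    candidate-blocks-conversion marked-i (_ , cross , L≡U) conv =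
      <-irrefl (sym L≡U) (proj₁ (convertible-marked⁻ S marked-i conv _) cross)

  module _ {i t : Edge} {A B} (adds : Adds t A B) where

    private
      candidate-self-adds : Candidate A i t → Candidate B i t
      candidate-self-adds (ht , cross , L≡U) =
        ht , cross , trans (proj₂ (adds-self adds)) (trans L≡U (sym (proj₁ (adds-self adds))))

      candidate-self-removes : Candidate B i t → Candidate A i t
      candidate-self-removes (ht , cross , L≡U) =
        ht , cross , trans (sym (proj₂ (adds-self adds))) (trans L≡U (proj₁ (adds-self adds)))

      deficient-adds : Candidate A i t → Deficient A i → Deficient B i
      deficient-adds (_ , (t<i , πi<πt) , _) (hi , neg) =
        hi , subst₂ _<_ (sym (L-adds-≮ adds (<-asym πi<πt))) (sym (U-adds-< adds t<i)) (m≤n⇒m≤1+n neg)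

      -- e_i and e_t are both marked in B, so U B i exceeds L B i by at least two.
      deficient-removes : lookup B i ≡ true → Candidate B i t → Deficient B i → Deficient A i
      deficient-removes marked-i (_ , (t<i , πi<πt) , Lt≡Ut) (hi , _) = hi , ≤-pred (begin
        suc (suc (L A i)) ≡⟨ cong (λ n → suc (suc n)) (L-adds-≮ adds (<-asym πi<πt)) ⟨
        suc (suc (L B i)) ≤⟨ s≤s (L-mono-marked B marked-i πi<πt) ⟩
        suc (L B t)       ≡⟨ cong suc Lt≡Ut ⟩
        suc (U B t)       ≤⟨ U-mono-marked B (marked-after adds) t<i ⟩
        U B i             ≡⟨ U-adds-< adds t<i ⟩
        suc (U A i)       ∎)
        where open ℕ.≤-Reasoning

      -- bdiff 0 would make e_k a later candidate, and πʳ k < πʳ i contradicts the counts.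
      crossed-by-candidate-positive : lookup A i ≡ true → Greatest (Candidate A i) t →
                                      ∀ {k} → k Fin.< i → Homogeneous k → U A k ≤ L A k →
                                      CrossesFromLeft t k → U A k < L A k
      crossed-by-candidate-positive marked-i ((_ , (_ , πi<πt) , Lt≡Ut) , later) {k} k<i hk nonneg (t<k , _)
        with πʳ i <? πʳ k
      ... | yes πi<πk = ≤∧≢⇒< nonneg λ U≡L → later t<k (hk , (k<i , πi<πk) , sym U≡L)
      ... | no  πi≮πk = contradiction (begin-strict
            U A t     ≤⟨ U-mono A (<⇒≤ t<k) ⟩
            U A k     ≤⟨ nonneg ⟩
            L A k     ≤⟨ L-mono A (≮⇒≥ πi≮πk) ⟩
            L A i     <⟨ L-mono-marked A marked-i πi<πt ⟩
            L A t     ≡⟨ Lt≡Ut ⟩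
            U A t     ∎) (<-irrefl refl)
        where open ℕ.≤-Reasoning

      later-candidate-adds : Greatest (Candidate A i) t → ∀ {k} → t Fin.< k → ¬ Candidate B i k
      later-candidate-adds ((_ , _ , Lt≡Ut) , later) {k} t<k (hk , cross , LB≡UB) with πʳ t <? πʳ k
      ... | yes πt<πk = later t<k (hk , cross , ℕ.suc-injective (begin
            suc (L A k) ≡⟨ L-adds-< adds πt<πk ⟨
            L B k       ≡⟨ LB≡UB ⟩
            U B k       ≡⟨ U-adds-< adds t<k ⟩
            suc (U A k) ∎))
        where open ≡-Reasoning
      ... | no  πt≮πk = contradiction (begin-strict
            L A k       ≤⟨ L-mono A (≮⇒≥ πt≮πk) ⟩
            L A t       ≡⟨ Lt≡Ut ⟩
            U A t       ≤⟨ U-mono A (<⇒≤ t<k) ⟩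
            U A k       <⟨ n<1+n _ ⟩
            suc (U A k) ≡⟨ U-adds-< adds t<k ⟨
            U B k       ≡⟨ LB≡UB ⟨
            L B k       ≡⟨ L-adds-≮ adds πt≮πk ⟩
            L A k       ∎) (<-irrefl refl)
        where open ℕ.≤-Reasoning

      later-candidate-removes : Least (Deficient B) i → Greatest (Candidate B i) t →
                                ∀ {k} → t Fin.< k → ¬ Candidate A i k
      later-candidate-removes (_ , earlier) (_ , later) {k} t<k (hk , cross@(k<i , _) , LA≡UA)
        with πʳ t <? πʳ k
      ... | yes πt<πk = later t<k (hk , cross , (begin
            L B k       ≡⟨ L-adds-< adds πt<πk ⟩
            suc (L A k) ≡⟨ cong suc LA≡UA ⟩
            suc (U A k) ≡⟨ U-adds-< adds t<k ⟨
            U B k       ∎))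
        where open ≡-Reasoning
      ... | no  πt≮πk = contradiction (¬deficient⇒nonneg {B} hk (earlier k<i)) (<⇒≱ (begin-strict
            L B k       ≡⟨ L-adds-≮ adds πt≮πk ⟩
            L A k       ≡⟨ LA≡UA ⟩
            U A k       <⟨ n<1+n _ ⟩
            suc (U A k) ≡⟨ U-adds-< adds t<k ⟨
            U B k       ∎))
        where open ℕ.≤-Reasoning

    case2b-adds : Case2b A i t → Case2b B i t
    case2b-adds ((def , earlier) , marked-i , greatest@(cand@(_ , (t<i , _) , _) , _)) =
      (deficient-adds cand def , earlier-nonneg) ,
      trans (sym (agree-elsewhere adds i (≢-sym (Fin.<⇒≢ t<i)))) marked-i ,
      candidate-self-adds cand , later-candidate-adds greatest
      where
      earlier-nonneg : ∀ {k} → k Fin.< i → ¬ Deficient B k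
      earlier-nonneg {k} k<i (hk , neg) =
        let nonneg = ¬deficient⇒nonneg {A} hk (earlier k<i)
        in <⇒≱ neg (nonneg-adds adds nonneg (crossed-by-candidate-positive marked-i greatest k<i hk nonneg))

    case2b-removes : Case2b B i t → Case2b A i t
    case2b-removes (least@(def , earlier) , marked-i , greatest@(cand@(_ , (t<i , _) , Lt≡Ut) , _)) =
      (deficient-removes marked-i cand def , earlier-nonneg) ,
      trans (agree-elsewhere adds i (≢-sym (Fin.<⇒≢ t<i))) marked-i ,
      candidate-self-removes cand , later-candidate-removes least greatest
      where
      earlier-nonneg : ∀ {k} → k Fin.< i → ¬ Deficient A k
      earlier-nonneg {k} k<i (hk , neg) =
        <⇒≱ neg (nonneg-removes adds (¬deficient⇒nonneg {B} hk (earlier k<i))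
                   (left-of-marked-positive {B} (marked-after adds) (ℕ.≤-reflexive (sym Lt≡Ut))))

  module _ (S : Marking′) where

    private
      ∈-homs⁺ : ∀ {k} → Homogeneous k → k ∈ homs ns π S
      ∈-homs⁺ = ∈-filterᵇ-allFin homogeneous-reflects

      ∈-homs⁻ : ∀ {k} → k ∈ homs ns π S → Homogeneous k
      ∈-homs⁻ {k} k∈ = fromT (homogeneous-reflects k) (proj₂ (∈-filter⁻ (T? ∘ homogeneous ns π) {xs = allFin _} k∈))

      homs-∷ : ∀ {k} → Homogeneous k → ∃₂ λ h hs → homs ns π S ≡ h ∷ hs
      homs-∷ hk with homs ns π S in eq
      ... | h ∷ hs = h , hs , refl
      ... | []     = contradiction hk (filterᵇ-allFin-[] homogeneous-reflects eq _)

      Φ-case2 : ∀ {i} → Least (Deficient S) i → Φ-marking ns π S ≡ case2 ns π S i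
      Φ-case2 least@((hi , _) , _) =
        let h , hs , homsEq = homs-∷ hi
            _ , negEq = filterᵇ-allFin-∷ (deficient-reflects S) least
        in trans (cong (Φ-marking-aux ns π S) homsEq) (cong (case12 ns π S h hs) (trans (negHoms≡ S) negEq))

    argminπ-lowest : ∀ {h hs} → homs ns π S ≡ h ∷ hs → LowestHomogeneous (argminπ ns π S h hs)
    argminπ-lowest {h} {hs} homsEq =
      ∈-homs⁻ (subst (argminπ ns π S h hs ∈_) (sym homsEq) (argminπ-∈ S h hs)) ,
      λ hk → argminπ-minimal S h hs (subst (_ ∈_) homsEq (∈-homs⁺ hk))

    negHoms-[] : negHoms ns π S ≡ [] → NoDeficient S
    negHoms-[] negEq = filterᵇ-allFin-[] (deficient-reflects S) (trans (sym (negHoms≡ S)) negEq)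

    negHoms-∷ : ∀ {i r} → negHoms ns π S ≡ i ∷ r → Least (Deficient S) i
    negHoms-∷ negEq = filterᵇ-allFin-head (deficient-reflects S) (trans (sym (negHoms≡ S)) negEq)

    case2bCandidates-last : ∀ {i t} → last (case2bCandidates ns π S i) ≡ just t → Greatest (Candidate S i) t
    case2bCandidates-last {i} lastEq =
      filterᵇ-allFin-last (candidate-reflects S i) (trans (sym (cong last (case2bCandidates≡ S i))) lastEq)

    Φ-case1 : ∀ {t} → LowestHomogeneous t → NoDeficient S → Φ-marking ns π S ≡ toggle ns π S t
    Φ-case1 {t} (ht , t-minimal) none =
      let h , hs , homsEq = homs-∷ ht
          a-homogeneous , a-minimal = argminπ-lowest homsEq
          a≡t = πʳ-injective (Fin.≤-antisym (a-minimal ht) (t-minimal a-homogeneous))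
          negEq = trans (negHoms≡ S) (filterᵇ-allFin-[]⁺ (deficient-reflects S) none)
      in trans (cong (Φ-marking-aux ns π S) homsEq)
               (trans (cong (case12 ns π S h hs) negEq) (cong (toggle ns π S) a≡t))

    Φ-case2a : ∀ {i} → Case2a S i → Φ-marking ns π S ≡ toggle ns π S i
    Φ-case2a {i} (least , conv) =
      trans (Φ-case2 least)
            (cong (λ b → if b then toggle ns π S i else case2b ns π S (last (case2bCandidates ns π S i)))
                  (det (convertible-reflects S i) (ofʸ conv)))

    Φ-case2b : ∀ {i t} → Case2b S i t → Φ-marking ns π S ≡ toggle ns π S t
    Φ-case2b {i} (least , marked-i , greatest@(cand , _)) =
      trans (Φ-case2 least)
            (cong₂ (λ b m → if b then toggle ns π S i else case2b ns π S m)
                   (det (convertible-reflects S i) (ofⁿ (candidate-blocks-conversion S marked-i cand)))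
                   (trans (cong last (case2bCandidates≡ S i)) (filterᵇ-allFin-last⁺ (candidate-reflects S i) greatest)))

    -- The paper shows that this case never occurs; here it is simply a fixed point of Φ.
    Φ-case2-without-candidate : ∀ {i} → Least (Deficient S) i → ¬ Convertible S i →
                                last (case2bCandidates ns π S i) ≡ nothing → Φ-marking ns π S ≡ S
    Φ-case2-without-candidate {i} least ¬conv lastEq =
      trans (Φ-case2 least)
            (cong₂ (λ b m → if b then toggle ns π S i else case2b ns π S m)
                   (det (convertible-reflects S i) (ofⁿ ¬conv)) lastEq)

  toggle-IsMarked : ∀ {S t} → Homogeneous t → IsMarked ns π S → IsMarked ns π (toggle ns π S t)
  toggle-IsMarked {S} {t} ht marked i inhomogeneous =
    subst T (sym (lookup∘updateAt′ i t i≢t S)) (marked i inhomogeneous)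
    where
    i≢t : i ≢ t
    i≢t refl = subst (T ∘ not) (det (homogeneous-reflects t) (ofʸ ht)) inhomogeneous

  data Φ-Step (S : Marking′) : Set where
    fixes   : Φ-marking ns π S ≡ S → Φ-Step S
    toggles : ∀ t → Homogeneous t → Φ-marking ns π S ≡ toggle ns π S t →
              Φ-marking ns π (toggle ns π S t) ≡ toggle ns π (toggle ns π S t) t → Φ-Step S

  module _ {S : Marking′} where

    case1-step : ∀ {t} → LowestHomogeneous t → NoDeficient S → Φ-Step S
    case1-step {t} lowest none =
      toggles t (proj₁ lowest) (Φ-case1 S lowest none)
        (Φ-case1 (toggle ns π S t) lowest
           (toggle-preserves NoDeficient {S} (λ adds → no-deficient-adds adds lowest)
                                             (λ adds → no-deficient-removes adds lowest) none))

    case2a-step : ∀ {i} → Case2a S i → Φ-Step S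
    case2a-step {i} case@(((hi , _) , _) , _) =
      toggles i hi (Φ-case2a S case)
        (Φ-case2a (toggle ns π S i) (toggle-preserves (λ S′ → Case2a S′ i) {S} case2a-adds case2a-removes case))

    case2b-step : ∀ {i t} → Case2b S i t → Φ-Step S
    case2b-step {i} {t} case@(_ , _ , (ht , _) , _) =
      toggles t ht (Φ-case2b S case)
        (Φ-case2b (toggle ns π S t) (toggle-preserves (λ S′ → Case2b S′ i t) {S} case2b-adds case2b-removes case))

  Φ-step : ∀ {S} → IsMarked ns π S → Φ-Step S
  Φ-step {S} marked with homs ns π S in homsEq
  ... | [] = fixes (cong (Φ-marking-aux ns π S) homsEq)
  ... | h ∷ hs with negHoms ns π S in negEq
  ...   | [] = case1-step (argminπ-lowest S homsEq) (negHoms-[] S negEq)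
  ...   | i ∷ _ with convertible ns π S i | convertible-reflects S i
  ...     | true  | ofʸ conv = case2a-step (negHoms-∷ S negEq , conv)
  ...     | false | ofⁿ ¬conv with last (case2bCandidates ns π S i) in lastEq
  ...       | nothing = fixes (Φ-case2-without-candidate S (negHoms-∷ S negEq) ¬conv lastEq)
  ...       | just t  =
    let least = negHoms-∷ S negEq
    in case2b-step (least , first-deficient-marked S marked least ¬conv , case2bCandidates-last S lastEq)

lemma4p5 : (ns : List ℕ) → All (0 <_) ns →
           (π : Permutation′ (sum ns)) (S : Marking (sum ns)) →
           IsMarked ns π S →
           IsMarked ns π (Φ-marking ns π S)
             × Φ-marking ns π (Φ-marking ns π S) ≡ S
lemma4p5 ns _ π S marked with Φ-step ns π marked
... | fixes Φ≡S = subst (IsMarked ns π) (sym Φ≡S) marked , trans (cong (Φ-marking ns π) Φ≡S) Φ≡S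
... | toggles t ht Φ≡S′ Φ′≡S =
  subst (IsMarked ns π) (sym Φ≡S′) (toggle-IsMarked ns π {S} ht marked) , (begin
    Φ-marking ns π (Φ-marking ns π S)      ≡⟨ cong (Φ-marking ns π) Φ≡S′ ⟩
    Φ-marking ns π (toggle ns π S t)       ≡⟨ Φ′≡S ⟩
    toggle ns π (toggle ns π S t) t        ≡⟨ toggle-involutive ns π S t ⟩
    S                                      ∎)
  where open ≡-Reasoning
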